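{- For all $n\geqslant 0$, the number of inversion sequences of size $n$ avoiding $010$ and $102$ equals the number of inversion sequences of size $n+1$ which avoid $010$ and $102$ and contain no entry equal to $1$.
   Context: An inversion sequence of size $n$ is a sequence $\sigma=(\sigma_1,\dots,\sigma_n)$ of integers with $\sigma_i\in\{0,\dots,i-1\}$. A sequence contains $010$ if it has entries at positions $a<b<c$ with $\sigma_a=\sigma_c<\sigma_b$, and contains $102$ if it has entries at positions $a<b<c$ with $\sigma_b<\sigma_a<\sigma_c$; otherwise it avoids them. -}

module Defs where

open import Data.Nat using (ℕ; suc)
open import Data.Fin using (Fin; toℕ; _<_)
open import Data.Product using (Σ; ∃-syntax; _×_; proj₁)
open import Data.Vec using (Vec; lookup)
open import Data.Nat using (_≤_)
open import Relation.Binary.PropositionalEquality using (_≡_)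
open import Relation.Nullary using (¬_)

-- Positions are 0-indexed here: position i : Fin n carries a value ≤ i,
-- i.e. paper position i+1 with value in {0,…,(i+1)-1}.
-- Represented as a Vec of entries (each < n) with the bound as side condition,
-- so that equality of sequences is first-order (no funext needed).
-- (The bound σᵢ ≤ i-1 is stored as an irrelevant field.)
record IsInvSeq {n : ℕ} (v : Vec (Fin n) n) : Set where
  constructor isInvSeq
  field
    .bound : (i : Fin n) → toℕ (lookup v i) ≤ toℕ i

InvSeq : ℕ → Set
InvSeq n = Σ (Vec (Fin n) n) IsInvSeq

val : ∀ {n} → InvSeq n → Fin n → ℕ
val σ i = toℕ (lookup (proj₁ σ) i)

open Data.Nat using () renaming (_<_ to _<ℕ_)

Contains010 : ∀ {n} → InvSeq n → Set
Contains010 {n} σ = ∃[ a ] ∃[ b ] ∃[ c ]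
  (a < b × b < c × val σ a ≡ val σ c × val σ c <ℕ val σ b)

Contains102 : ∀ {n} → InvSeq n → Set
Contains102 {n} σ = ∃[ a ] ∃[ b ] ∃[ c ]
  (a < b × b < c × val σ b <ℕ val σ a × val σ a <ℕ val σ c)

HasOne : ∀ {n} → InvSeq n → Set
HasOne σ = ∃[ i ] val σ i ≡ 1

-- Avoidance property, as a record with irrelevant fields so that it is
-- proof-irrelevant (the subtype below is then a genuine subset).
record Avoids010-102 {n : ℕ} (σ : InvSeq n) : Set where
  constructor avoids
  field
    .no010 : ¬ Contains010 σ
    .no102 : ¬ Contains102 σ

record Avoids010-102-no1 {n : ℕ} (σ : InvSeq n) : Set where
  constructor avoids-no1
  field
    .no010 : ¬ Contains010 σ
    .no102 : ¬ Contains102 σ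
    .no1   : ¬ HasOne σ

I-010-102 : ℕ → Set
I-010-102 n = Σ (InvSeq n) Avoids010-102

I-010-102-no1 : ℕ → Set
I-010-102-no1 n = Σ (InvSeq n) Avoids010-102-no1

-- Prepend a 0 to σ and raise every positive entry by one; conversely drop the
-- first entry and lower every positive entry by one.  The value map 0 ↦ 0, k+1 ↦ k+2
-- is strictly increasing, so it neither creates nor destroys 010 or 102 among the
-- shifted entries.  The new leading 0 could only start a 010 by sitting before a
-- positive entry followed by a 0, but an inversion sequence already starts with 0;
-- and a 0 can never play the role of the 1 in 102.
module Submission where

open import Defs
open import Data.Empty using (⊥-elim)
import Data.Empty.Irrelevant as Irrelevant
open import Data.Fin as Fin using (Fin; zero; suc; toℕ; pinch)
open import Data.Fin.Properties using (toℕ-injective)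
open import Data.Nat using (ℕ; zero; suc; pred; _≤_; _<_; z≤n; s≤s; z<s; s<s; s<s⁻¹)
open import Data.Nat.Properties
  using (<-cmp; <-irrefl; <-asym; n≮0; ≤-refl; pred-mono-≤; module ≤-Reasoning)
open import Data.Product using (∃-syntax; _×_; _,_)
open import Data.Product.Properties using (Σ-≡,≡→≡)
open import Data.Sum using (_⊎_; inj₁; inj₂)
open import Data.Vec using (Vec; []; _∷_; lookup; map; tail)
open import Data.Vec.Properties using (lookup-map; tabulate∘lookup; tabulate-cong)
import Data.Vec.Functional as Vector
open import Function using (_∘_; _↔_; mk↔ₛ′)
open import Relation.Binary using (tri<; tri≈; tri>; _Preserves_⟶_)
open import Relation.Binary.PropositionalEquality
  using (_≡_; _≢_; _≗_; refl; sym; trans; cong; subst)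
open import Relation.Nullary using (¬_)

private
  variable
    n : ℕ
    h : ℕ → ℕ
    x y z : ℕ

strictMono⇒cancel-< : h Preserves _<_ ⟶ _<_ → h x < h y → x < y
strictMono⇒cancel-< {x = x} {y} mono hx<hy with <-cmp x y
... | tri< x<y _ _ = x<y
... | tri≈ _ refl _ = ⊥-elim (<-irrefl refl hx<hy)
... | tri> _ _ y<x = ⊥-elim (<-asym hx<hy (mono y<x))

strictMono⇒injective : h Preserves _<_ ⟶ _<_ → h x ≡ h y → x ≡ y
strictMono⇒injective {x = x} {y} mono hx≡hy with <-cmp x y
... | tri< x<y _ _ = ⊥-elim (<-irrefl hx≡hy (mono x<y))
... | tri≈ _ x≡y _ = x≡y
... | tri> _ _ y<x = ⊥-elim (<-irrefl (sym hx≡hy) (mono y<x))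

Pattern010 Pattern102 : ℕ → ℕ → ℕ → Set
Pattern010 x y z = x ≡ z × z < y
Pattern102 x y z = y < x × x < z

Occurs : (ℕ → ℕ → ℕ → Set) → (Fin n → ℕ) → Set
Occurs P s = ∃[ a ] ∃[ b ] ∃[ c ] (a Fin.< b × b Fin.< c × P (s a) (s b) (s c))

pattern010-map : h Preserves _<_ ⟶ _<_ → Pattern010 x y z → Pattern010 (h x) (h y) (h z)
pattern010-map {h = h} mono (x≡z , z<y) = cong h x≡z , mono z<y

pattern010-unmap : h Preserves _<_ ⟶ _<_ → Pattern010 (h x) (h y) (h z) → Pattern010 x y z
pattern010-unmap mono (hx≡hz , hz<hy) =
  strictMono⇒injective mono hx≡hz , strictMono⇒cancel-< mono hz<hy

pattern102-map : h Preserves _<_ ⟶ _<_ → Pattern102 x y z → Pattern102 (h x) (h y) (h z)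
pattern102-map mono (y<x , x<z) = mono y<x , mono x<z

pattern102-unmap : h Preserves _<_ ⟶ _<_ → Pattern102 (h x) (h y) (h z) → Pattern102 x y z
pattern102-unmap mono (hy<hx , hx<hz) =
  strictMono⇒cancel-< mono hy<hx , strictMono⇒cancel-< mono hx<hz

module _ (P : ℕ → ℕ → ℕ → Set) where

  occurs-resp : {s t : Fin n → ℕ} → s ≗ t → Occurs P s → Occurs P t
  occurs-resp {s = s} s≗t (a , b , c , a<b , b<c , p)
    with s a | s≗t a | s b | s≗t b | s c | s≗t c
  ... | _ | refl | _ | refl | _ | refl = a , b , c , a<b , b<c , p

  occurs-map : {s : Fin n → ℕ} → (∀ {x y z} → P x y z → P (h x) (h y) (h z)) →
               Occurs P s → Occurs P (h ∘ s)
  occurs-map f (a , b , c , a<b , b<c , p) = a , b , c , a<b , b<c , f p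

  occurs-unmap : {s : Fin n → ℕ} → (∀ {x y z} → P (h x) (h y) (h z) → P x y z) →
                 Occurs P (h ∘ s) → Occurs P s
  occurs-unmap f (a , b , c , a<b , b<c , p) = a , b , c , a<b , b<c , f p

  occurs-tail : {s : Fin (suc n) → ℕ} → Occurs P (Vector.tail s) → Occurs P s
  occurs-tail (a , b , c , a<b , b<c , p) = suc a , suc b , suc c , s<s a<b , s<s b<c , p

  occurs-∷⁻ : {s : Fin n → ℕ} → Occurs P (x Vector.∷ s) →
              Occurs P s ⊎ ∃[ b ] ∃[ c ] (b Fin.< c × P x (s b) (s c))
  occurs-∷⁻ (zero , suc b , suc c , _ , b<c , p) = inj₂ (b , c , s<s⁻¹ b<c , p)
  occurs-∷⁻ (suc a , suc b , suc c , a<b , b<c , p) =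
    inj₁ (a , b , c , s<s⁻¹ a<b , s<s⁻¹ b<c , p)

occurs010-∷-zero : {s : Fin n → ℕ} → (∀ b → 0 < s b → ∃[ a ] (a Fin.< b × s a ≡ 0)) →
                   Occurs Pattern010 (0 Vector.∷ s) → Occurs Pattern010 s
occurs010-∷-zero {s = s} zero-before occ with occurs-∷⁻ Pattern010 occ
... | inj₁ occ′ = occ′
... | inj₂ (b , c , b<c , 0≡sc , sc<sb)
  with zero-before b (subst (_< s b) (sym 0≡sc) sc<sb)
... | a , a<b , sa≡0 = a , b , c , a<b , b<c , trans sa≡0 0≡sc , sc<sb

occurs102-∷-zero : {s : Fin n → ℕ} → Occurs Pattern102 (0 Vector.∷ s) → Occurs Pattern102 s
occurs102-∷-zero {s = s} occ with occurs-∷⁻ Pattern102 occ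
... | inj₁ occ′ = occ′
... | inj₂ (_ , _ , _ , y<0 , _) = ⊥-elim (n≮0 y<0)

skipOne : ℕ → ℕ
skipOne zero = zero
skipOne (suc x) = suc (suc x)

skipOne-mono-< : skipOne Preserves _<_ ⟶ _<_
skipOne-mono-< {zero} {suc y} _ = z<s
skipOne-mono-< {suc x} {suc y} x<y = s<s x<y

skipOne≢1 : ∀ x → skipOne x ≢ 1
skipOne≢1 zero ()
skipOne≢1 (suc x) ()

skipOne≤suc : ∀ x → skipOne x ≤ suc x
skipOne≤suc zero = z≤n
skipOne≤suc (suc x) = ≤-refl

pred-skipOne : ∀ x → pred (skipOne x) ≡ x
pred-skipOne zero = refl
pred-skipOne (suc x) = refl

skipOne-pred : ∀ x → .(x ≢ 1) → skipOne (pred x) ≡ x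
skipOne-pred zero _ = refl
skipOne-pred (suc zero) x≢1 = Irrelevant.⊥-elim (x≢1 refl)
skipOne-pred (suc (suc x)) _ = refl

skipOneᶠ : Fin n → Fin (suc n)
skipOneᶠ zero = zero
skipOneᶠ (suc i) = suc (suc i)

toℕ-skipOneᶠ : (i : Fin n) → toℕ (skipOneᶠ i) ≡ skipOne (toℕ i)
toℕ-skipOneᶠ zero = refl
toℕ-skipOneᶠ (suc i) = refl

toℕ-pinch-zero : (i : Fin (suc (suc n))) → toℕ (pinch zero i) ≡ pred (toℕ i)
toℕ-pinch-zero zero = refl
toℕ-pinch-zero (suc i) = refl

lookup-ext : {A : Set} {v w : Vec A n} → lookup v ≗ lookup w → v ≡ w
lookup-ext {v = v} {w} v≗w =
  trans (sym (tabulate∘lookup v)) (trans (tabulate-cong v≗w) (tabulate∘lookup w))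

InvSeq-≡ : {σ τ : InvSeq n} → val σ ≗ val τ → σ ≡ τ
InvSeq-≡ σ≗τ = Σ-≡,≡→≡ (lookup-ext (toℕ-injective ∘ σ≗τ) , refl)

val-zero : (σ : InvSeq (suc n)) → val σ zero ≡ 0
val-zero (zero ∷ _ , _) = refl
val-zero (suc _ ∷ _ , isInvSeq bound) = Irrelevant.⊥-elim (n≮0 (bound zero))

positive-preceded-by-zero : (σ : InvSeq n) (b : Fin n) → 0 < val σ b →
                            ∃[ a ] (a Fin.< b × val σ a ≡ 0)
positive-preceded-by-zero σ zero 0<σ₀ = ⊥-elim (<-irrefl (sym (val-zero σ)) 0<σ₀)
positive-preceded-by-zero σ (suc b) _ = zero , z<s , val-zero σ

extendVec : Vec (Fin n) n → Vec (Fin (suc n)) (suc n)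
extendVec v = zero ∷ map skipOneᶠ v

toℕ-lookup-extendVec : (v : Vec (Fin n) n) →
                       toℕ ∘ lookup (extendVec v) ≗ skipOne ∘ (0 Vector.∷ toℕ ∘ lookup v)
toℕ-lookup-extendVec v zero = refl
toℕ-lookup-extendVec v (suc i) =
  trans (cong toℕ (lookup-map i skipOneᶠ v)) (toℕ-skipOneᶠ (lookup v i))

extendVec-bound : {v : Vec (Fin n) n} → (∀ i → toℕ (lookup v i) ≤ toℕ i) →
                  ∀ i → toℕ (lookup (extendVec v) i) ≤ toℕ i
extendVec-bound _ zero = z≤n
extendVec-bound {v = v} bound (suc i) = begin
  toℕ (lookup (extendVec v) (suc i)) ≡⟨ toℕ-lookup-extendVec v (suc i) ⟩
  skipOne (toℕ (lookup v i))         ≤⟨ skipOne≤suc _ ⟩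
  suc (toℕ (lookup v i))             ≤⟨ s≤s (bound i) ⟩
  suc (toℕ i)                        ∎
  where open ≤-Reasoning

-- pinch zero : Fin (suc n) → Fin n only exists for n ≥ 1; for n = 0 the tail is empty.
restrictVec : Vec (Fin (suc n)) (suc n) → Vec (Fin n) n
restrictVec {zero} _ = []
restrictVec {suc n} v = map (pinch zero) (tail v)

toℕ-lookup-restrictVec : (v : Vec (Fin (suc n)) (suc n)) →
                         toℕ ∘ lookup (restrictVec v) ≗ pred ∘ Vector.tail (toℕ ∘ lookup v)
toℕ-lookup-restrictVec {suc n} (_ ∷ v) i =
  trans (cong toℕ (lookup-map i (pinch zero) v)) (toℕ-pinch-zero (lookup v i))

restrictVec-bound : {v : Vec (Fin (suc n)) (suc n)} → (∀ i → toℕ (lookup v i) ≤ toℕ i) →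
                    ∀ i → toℕ (lookup (restrictVec v) i) ≤ toℕ i
restrictVec-bound {v = v} bound i = begin
  toℕ (lookup (restrictVec v) i) ≡⟨ toℕ-lookup-restrictVec v i ⟩
  pred (toℕ (lookup v (suc i)))  ≤⟨ pred-mono-≤ (bound (suc i)) ⟩
  toℕ i                          ∎
  where open ≤-Reasoning

extend : InvSeq n → InvSeq (suc n)
extend (v , isInvSeq bound) = extendVec v , isInvSeq (extendVec-bound bound)

restrict : InvSeq (suc n) → InvSeq n
restrict (v , isInvSeq bound) = restrictVec v , isInvSeq (restrictVec-bound bound)

val-extend : (σ : InvSeq n) → val (extend σ) ≗ skipOne ∘ (0 Vector.∷ val σ)
val-extend (v , _) = toℕ-lookup-extendVec v

val-restrict : (τ : InvSeq (suc n)) → val (restrict τ) ≗ pred ∘ Vector.tail (val τ)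
val-restrict (v , _) = toℕ-lookup-restrictVec v

extend-noOne : (σ : InvSeq n) → ¬ HasOne (extend σ)
extend-noOne σ (i , σᵢ≡1) = skipOne≢1 _ (trans (sym (val-extend σ i)) σᵢ≡1)

restrict-extend : (σ : InvSeq n) → restrict (extend σ) ≡ σ
restrict-extend σ = InvSeq-≡ λ i →
  trans (val-restrict (extend σ) i)
        (trans (cong pred (val-extend σ (suc i))) (pred-skipOne (val σ i)))

extend-restrict : (τ : InvSeq (suc n)) → .(¬ HasOne τ) → extend (restrict τ) ≡ τ
extend-restrict τ noOne = InvSeq-≡ λ where
  zero    → sym (val-zero τ)
  (suc i) → trans (val-extend (restrict τ) (suc i))
                  (trans (cong skipOne (val-restrict τ i))
                         (skipOne-pred (val τ (suc i)) λ τᵢ≡1 → noOne (suc i , τᵢ≡1)))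

extend-avoids010 : (σ : InvSeq n) → ¬ Contains010 σ → ¬ Contains010 (extend σ)
extend-avoids010 σ no010 =
  no010 ∘ occurs010-∷-zero (positive-preceded-by-zero σ)
        ∘ occurs-unmap Pattern010 (pattern010-unmap skipOne-mono-<)
        ∘ occurs-resp Pattern010 (val-extend σ)

extend-avoids102 : (σ : InvSeq n) → ¬ Contains102 σ → ¬ Contains102 (extend σ)
extend-avoids102 σ no102 =
  no102 ∘ occurs102-∷-zero
        ∘ occurs-unmap Pattern102 (pattern102-unmap skipOne-mono-<)
        ∘ occurs-resp Pattern102 (val-extend σ)

-- Without entries 1, raising the positive entries of restrict τ recovers the tail of τ.
restrict-reflects : (P : ℕ → ℕ → ℕ → Set) →
                    (∀ {x y z} → P x y z → P (skipOne x) (skipOne y) (skipOne z)) →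
                    (τ : InvSeq (suc n)) → ¬ HasOne τ →
                    Occurs P (val (restrict τ)) → Occurs P (val τ)
restrict-reflects P map-P τ noOne =
  occurs-tail P ∘ occurs-resp P skipOne-pred-tail ∘ occurs-map P map-P
              ∘ occurs-resp P (val-restrict τ)
  where
  skipOne-pred-tail : skipOne ∘ pred ∘ Vector.tail (val τ) ≗ Vector.tail (val τ)
  skipOne-pred-tail i = skipOne-pred (val τ (suc i)) λ τᵢ≡1 → noOne (suc i , τᵢ≡1)

corollary4p3 : (n : ℕ) → I-010-102 n ↔ I-010-102-no1 (suc n)
corollary4p3 n = mk↔ₛ′ to from to∘from from∘to
  where
  to : I-010-102 n → I-010-102-no1 (suc n)
  to (σ , avoids no010 no102) =
    extend σ , avoids-no1 (extend-avoids010 σ no010) (extend-avoids102 σ no102) (extend-noOne σ)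

  from : I-010-102-no1 (suc n) → I-010-102 n
  from (τ , avoids-no1 no010 no102 noOne) =
    restrict τ ,
    avoids (no010 ∘ restrict-reflects Pattern010 (pattern010-map skipOne-mono-<) τ noOne)
           (no102 ∘ restrict-reflects Pattern102 (pattern102-map skipOne-mono-<) τ noOne)

  to∘from : ∀ τ → to (from τ) ≡ τ
  to∘from (τ , avoids-no1 _ _ noOne) = Σ-≡,≡→≡ (extend-restrict τ noOne , refl)

  from∘to : ∀ σ → from (to σ) ≡ σ
  from∘to (σ , _) = Σ-≡,≡→≡ (restrict-extend σ , refl)
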